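{- Let $p$ be a prime, let $a$ be a positive integer with $a\not\equiv0\pmod p$, put $\tau_{p}(a):=\sum_{j=1}^{p-1} j\,p^{ja-1}$ and $k_p:=(p^p-1)/(p-1)$. Then \[ \tau_{p}(a)(p^{a}-1) \equiv 1 \pmod{k_{p}}. \] -}

module Defs where

open import Data.Nat using (ℕ; zero; suc; _+_; _*_; _∸_; _^_; _/_)
open import Data.List using (List; map; upTo)
open import Data.Nat.ListAction using (sum)

-- τ_p(a) = Σ_{j=1}^{p-1} j * p^(j*a - 1)
-- (for a ≥ 1, j ≥ 1 the exponent j*a - 1 is a genuine natural number)
τ : ℕ → ℕ → ℕ
τ p a = sum (map (λ i → let j = suc i in j * p ^ (j * a ∸ 1)) (upTo (p ∸ 1)))

-- k_p = (p^p - 1)/(p - 1); the division is exact for p ≥ 2.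
-- For p < 2 (never a prime) we put k_p = 0 as a junk value.
k : ℕ → ℕ
k zero = 0
k (suc zero) = 0
k p@(suc (suc q)) = (p ^ p ∸ 1) / suc q

{-# OPTIONS --safe #-}
-- Write X = p^a and K = k_p = 1 + p + ⋯ + p^(p-1). Multiplying τ by p gives Σ_{j<p} j Xʲ,
-- and telescoping turns this into p (τ (X - 1) - 1) = (p - 1)(Xᵖ - 1) - (1 + X + ⋯ + X^(p-1)).
-- K divides pᵖ - 1 and hence Xᵖ - 1 = (pᵖ)ᵃ - 1. As gcd(a, p) = 1, a common divisor of K and
-- X - 1 divides both pᵖ - 1 and pᵃ - 1, hence p - 1, while K ≡ p ≡ 1 mod p - 1; so K is coprime
-- to X - 1 and divides 1 + X + ⋯ + X^(p-1) = (Xᵖ - 1)/(X - 1). Therefore K divides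
-- p (τ (X - 1) - 1), and K ≡ 1 mod p lets us cancel p.

module Submission where

open import Defs
open import Data.Nat using (ℕ; zero; suc; _^_; _>_)
import Data.Nat as ℕ
import Data.Nat.Properties as ℕ
import Data.Nat.Divisibility as ℕ
open import Data.Nat.Divisibility using (_∤_)
open import Data.Nat.DivMod using (m*n/n≡m)
open import Data.Nat.Primality using (Prime; prime⇒irreducible; ¬prime[0]; ¬prime[1])
open import Data.Nat.GCD using (module Bézout)
import Data.Nat.Coprimality as ℕ
open import Data.Nat.ListAction using (sum)
open import Data.Nat.ListAction.Properties using (sum-++)
open import Data.List using (map; upTo; _++_; [_])
open import Data.List.Properties using (upTo-∷ʳ; map-++)
open import Data.Integer using (ℤ; +_; 0ℤ; 1ℤ; _+_; _-_; _*_; ∣_∣)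
import Data.Integer as ℤ
open import Data.Integer.Properties using (pos-*; abs-*; *-comm; *-zeroʳ; *-distribˡ-+; ^-*-assoc; ⊖-≥)
open import Data.Integer.Divisibility using (_∣_)
open import Data.Integer.Divisibility.Signed
  using (divides; ∣ᵤ⇒∣; ∣⇒∣ᵤ; ∣-refl; ∣-trans; ∣m∣n⇒∣m+n; ∣m∣n⇒∣m-n; ∣n⇒∣m*n)
  renaming (_∣_ to _∣ₛ_)
open import Data.Integer.Coprimality using (Coprime; coprime-divisor)
open import Data.Integer.Tactic.RingSolver using (solve-∀)
open import Data.Nat.Tactic.RingSolver using () renaming (solve-∀ to ℕ-solve-∀)
open import Data.Product using (_,_)
open import Data.Sum using (inj₁; inj₂)
open import Function using (_∘_)
open import Relation.Binary.PropositionalEquality using (_≡_; refl; sym; trans; cong; cong₂; subst; module ≡-Reasoning)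
open import Relation.Nullary using (contradiction)

open ≡-Reasoning

pos-^ : ∀ m n → + (m ^ n) ≡ (+ m) ℤ.^ n
pos-^ m zero    = refl
pos-^ m (suc n) = trans (pos-* m (m ^ n)) (cong (+ m *_) (pos-^ m n))

geom : ℤ → ℕ → ℤ
geom u zero    = 0ℤ
geom u (suc n) = 1ℤ + u * geom u n

geom-sucʳ : ∀ u n → geom u (suc n) ≡ geom u n + u ℤ.^ n
geom-sucʳ u zero    = cong (_+_ 1ℤ) (*-zeroʳ u)
geom-sucʳ u (suc n) = begin
  1ℤ + u * geom u (suc n)         ≡⟨ cong (λ g → 1ℤ + u * g) (geom-sucʳ u n) ⟩
  1ℤ + u * (geom u n + u ℤ.^ n)   ≡⟨ distrib u (geom u n) (u ℤ.^ n) ⟩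
  geom u (suc n) + u ℤ.^ suc n    ∎
  where
  distrib : ∀ u g w → 1ℤ + u * (g + w) ≡ (1ℤ + u * g) + u * w
  distrib = solve-∀

[u-1]*geom≡uⁿ-1 : ∀ u n → (u - 1ℤ) * geom u n ≡ u ℤ.^ n - 1ℤ
[u-1]*geom≡uⁿ-1 u zero    = *-zeroʳ (u - 1ℤ)
[u-1]*geom≡uⁿ-1 u (suc n) = begin
  (u - 1ℤ) * (1ℤ + u * geom u n)       ≡⟨ expand u (geom u n) ⟩
  u - 1ℤ + u * ((u - 1ℤ) * geom u n)   ≡⟨ cong (λ z → u - 1ℤ + u * z) ([u-1]*geom≡uⁿ-1 u n) ⟩
  u - 1ℤ + u * (u ℤ.^ n - 1ℤ)          ≡⟨ collapse u (u ℤ.^ n) ⟩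
  u ℤ.^ suc n - 1ℤ                     ∎
  where
  expand : ∀ u g → (u - 1ℤ) * (1ℤ + u * g) ≡ u - 1ℤ + u * ((u - 1ℤ) * g)
  expand = solve-∀
  collapse : ∀ u w → u - 1ℤ + u * (w - 1ℤ) ≡ u * w - 1ℤ
  collapse = solve-∀

geom∣uⁿ-1 : ∀ u n → geom u n ∣ₛ u ℤ.^ n - 1ℤ
geom∣uⁿ-1 u n = divides (u - 1ℤ) (sym ([u-1]*geom≡uⁿ-1 u n))

u-1∣uⁿ-1 : ∀ u n → u - 1ℤ ∣ₛ u ℤ.^ n - 1ℤ
u-1∣uⁿ-1 u n = divides (geom u n) (trans (sym ([u-1]*geom≡uⁿ-1 u n)) (*-comm (u - 1ℤ) (geom u n)))

u-1∣geom-n : ∀ u n → u - 1ℤ ∣ₛ geom u n - + n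
u-1∣geom-n u zero    = divides 0ℤ refl
u-1∣geom-n u (suc n) = subst (u - 1ℤ ∣ₛ_) (sym split) (∣m∣n⇒∣m+n (u-1∣geom-n u n) (u-1∣uⁿ-1 u n))
  where
  regroup : ∀ g w m → (g + w) - (1ℤ + m) ≡ (g - m) + (w - 1ℤ)
  regroup = solve-∀
  split : geom u (suc n) - + suc n ≡ (geom u n - + n) + (u ℤ.^ n - 1ℤ)
  split = trans (cong (_- + suc n) (geom-sucʳ u n)) (regroup (geom u n) (u ℤ.^ n) (+ n))

weighted : ℤ → ℕ → ℤ
weighted u zero    = 0ℤ
weighted u (suc n) = weighted u n + + suc n * u ℤ.^ suc n

[u-1]*weighted+geom : ∀ u n → (u - 1ℤ) * weighted u n + geom u (suc n) ≡ + n * u ℤ.^ suc n + 1ℤ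
[u-1]*weighted+geom u zero    = base u
  where
  base : ∀ u → (u - 1ℤ) * 0ℤ + (1ℤ + u * 0ℤ) ≡ 0ℤ * (u * 1ℤ) + 1ℤ
  base = solve-∀
[u-1]*weighted+geom u (suc n) = begin
  (u - 1ℤ) * (weighted u n + + suc n * w) + geom u (suc (suc n))
    ≡⟨ cong (_+_ ((u - 1ℤ) * (weighted u n + + suc n * w))) (geom-sucʳ u (suc n)) ⟩
  (u - 1ℤ) * (weighted u n + + suc n * w) + (geom u (suc n) + w)
    ≡⟨ regroup u (weighted u n) (geom u (suc n)) w (+ n) ⟩
  ((u - 1ℤ) * weighted u n + geom u (suc n)) + ((u - 1ℤ) * + suc n * w + w)
    ≡⟨ cong (_+ ((u - 1ℤ) * + suc n * w + w)) ([u-1]*weighted+geom u n) ⟩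
  (+ n * w + 1ℤ) + ((u - 1ℤ) * + suc n * w + w)
    ≡⟨ collect u w (+ n) ⟩
  + suc n * (u * w) + 1ℤ
    ∎
  where
  w : ℤ
  w = u ℤ.^ suc n
  regroup : ∀ u W g w m → (u - 1ℤ) * (W + (1ℤ + m) * w) + (g + w)
                        ≡ ((u - 1ℤ) * W + g) + ((u - 1ℤ) * (1ℤ + m) * w + w)
  regroup = solve-∀
  collect : ∀ u w m → (m * w + 1ℤ) + ((u - 1ℤ) * (1ℤ + m) * w + w) ≡ (1ℤ + m) * (u * w) + 1ℤ
  collect = solve-∀

[1+n]*[t*[u-1]-1]≡n*[uⁿ⁺¹-1]-geom : ∀ u n t → + suc n * t ≡ weighted u n →
                    + suc n * (t * (u - 1ℤ) - 1ℤ) ≡ + n * (u ℤ.^ suc n - 1ℤ) - geom u (suc n)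
[1+n]*[t*[u-1]-1]≡n*[uⁿ⁺¹-1]-geom u n t eq = begin
  + suc n * (t * (u - 1ℤ) - 1ℤ)                     ≡⟨ expand u t (+ n) ⟩
  (u - 1ℤ) * (+ suc n * t) - + suc n                ≡⟨ cong (λ z → (u - 1ℤ) * z - + suc n) eq ⟩
  (u - 1ℤ) * weighted u n - + suc n                 ≡⟨ shift u (weighted u n) (geom u (suc n)) (+ n) ⟩
  ((u - 1ℤ) * weighted u n + geom u (suc n)) - geom u (suc n) - + suc n
    ≡⟨ cong (λ z → z - geom u (suc n) - + suc n) ([u-1]*weighted+geom u n) ⟩
  (+ n * u ℤ.^ suc n + 1ℤ) - geom u (suc n) - + suc n ≡⟨ collect (u ℤ.^ suc n) (geom u (suc n)) (+ n) ⟩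
  + n * (u ℤ.^ suc n - 1ℤ) - geom u (suc n)         ∎
  where
  expand : ∀ u t m → (1ℤ + m) * (t * (u - 1ℤ) - 1ℤ) ≡ (u - 1ℤ) * ((1ℤ + m) * t) - (1ℤ + m)
  expand = solve-∀
  shift : ∀ u W g m → (u - 1ℤ) * W - (1ℤ + m) ≡ ((u - 1ℤ) * W + g) - g - (1ℤ + m)
  shift = solve-∀
  collect : ∀ w g m → (m * w + 1ℤ) - g - (1ℤ + m) ≡ m * (w - 1ℤ) - g
  collect = solve-∀

∣uᵃ-1⇒∣uᵃⁿ-1 : ∀ {d} u a n → d ∣ₛ u ℤ.^ a - 1ℤ → d ∣ₛ u ℤ.^ (a ℕ.* n) - 1ℤ
∣uᵃ-1⇒∣uᵃⁿ-1 u a n d∣uᵃ-1 =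
  ∣-trans d∣uᵃ-1 (subst (_ ∣ₛ_) (cong (_- 1ℤ) (^-*-assoc u a n)) (u-1∣uⁿ-1 (u ℤ.^ a) n))

∣u¹⁺ᵐ-1∧∣uᵐ-1⇒∣u-1 : ∀ {d} u m → d ∣ₛ u ℤ.^ suc m - 1ℤ → d ∣ₛ u ℤ.^ m - 1ℤ → d ∣ₛ u - 1ℤ
∣u¹⁺ᵐ-1∧∣uᵐ-1⇒∣u-1 u m d∣u¹⁺ᵐ-1 d∣uᵐ-1 =
  subst (_ ∣ₛ_) (cancel u (u ℤ.^ m)) (∣m∣n⇒∣m-n d∣u¹⁺ᵐ-1 (∣n⇒∣m*n u d∣uᵐ-1))
  where
  cancel : ∀ u v → u * v - 1ℤ - u * (v - 1ℤ) ≡ u - 1ℤ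
  cancel = solve-∀

-- Bézout for the exponents: a x = 1 + b y (or the symmetric form), so uᵃˣ = u · uᵇʸ.
∣uᵃ-1∧∣uᵇ-1⇒∣u-1 : ∀ {d} u {a b} → ℕ.Coprime a b →
                   d ∣ₛ u ℤ.^ a - 1ℤ → d ∣ₛ u ℤ.^ b - 1ℤ → d ∣ₛ u - 1ℤ
∣uᵃ-1∧∣uᵇ-1⇒∣u-1 {d} u {a} {b} a⊥b d∣uᵃ-1 d∣uᵇ-1 with ℕ.coprime-Bézout a⊥b
... | Bézout.+- x y 1+yb≡xa = ∣u¹⁺ᵐ-1∧∣uᵐ-1⇒∣u-1 u (b ℕ.* y)
  (subst (λ e → d ∣ₛ u ℤ.^ e - 1ℤ) (trans (ℕ.*-comm a x) (sym (trans (cong suc (ℕ.*-comm b y)) 1+yb≡xa)))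
    (∣uᵃ-1⇒∣uᵃⁿ-1 u a x d∣uᵃ-1))
  (∣uᵃ-1⇒∣uᵃⁿ-1 u b y d∣uᵇ-1)
... | Bézout.-+ x y 1+xa≡yb = ∣u¹⁺ᵐ-1∧∣uᵐ-1⇒∣u-1 u (a ℕ.* x)
  (subst (λ e → d ∣ₛ u ℤ.^ e - 1ℤ) (trans (ℕ.*-comm b y) (sym (trans (cong suc (ℕ.*-comm a x)) 1+xa≡yb)))
    (∣uᵃ-1⇒∣uᵃⁿ-1 u b y d∣uᵇ-1))
  (∣uᵃ-1⇒∣uᵃⁿ-1 u a x d∣uᵃ-1)

common-divisor∣1⇒coprime : ∀ {x y} → (∀ {d} → d ∣ₛ x → d ∣ₛ y → d ∣ₛ 1ℤ) → Coprime x y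
common-divisor∣1⇒coprime {x} {y} h {d} (d∣x , d∣y) =
  ℕ.∣1⇒≡1 (∣⇒∣ᵤ (h (∣ᵤ⇒∣ {+ d} {x} d∣x) (∣ᵤ⇒∣ {+ d} {y} d∣y)))

geom-suc-coprime : ∀ u n → Coprime (geom u (suc n)) u
geom-suc-coprime u n = common-divisor∣1⇒coprime {geom u (suc n)} {u} λ {d} d∣geom d∣u →
  subst (d ∣ₛ_) (cancel u (geom u n)) (∣m∣n⇒∣m-n d∣geom (∣n⇒∣m*n (geom u n) d∣u))
  where
  cancel : ∀ u g → 1ℤ + u * g - g * u ≡ 1ℤ
  cancel = solve-∀

prime∧∤⇒coprime : ∀ {p n} → Prime p → p ∤ n → ℕ.Coprime p n
prime∧∤⇒coprime pp p∤n (d∣p , d∣n) with prime⇒irreducible pp d∣p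
... | inj₁ d≡1  = d≡1
... | inj₂ refl = contradiction d∣n p∤n

coprime∧∣∧∣⇒∣1 : ∀ {d x y} → Coprime x y → d ∣ₛ x → d ∣ₛ y → d ∣ₛ 1ℤ
coprime∧∣∧∣⇒∣1 {d} x⊥y d∣x d∣y = ∣ᵤ⇒∣ {d} {1ℤ} (ℕ.∣-reflexive (x⊥y (∣⇒∣ᵤ d∣x , ∣⇒∣ᵤ d∣y)))

geom-self-coprime-pred : ∀ n → Coprime (geom (+ n) n) (+ n - 1ℤ)
geom-self-coprime-pred n = common-divisor∣1⇒coprime {geom (+ n) n} {+ n - 1ℤ} λ {d} d∣g d∣n-1 →
  subst (d ∣ₛ_) (cancel (geom (+ n) n)) (∣m∣n⇒∣m-n d∣g (∣-trans d∣n-1 n-1∣g-1))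
  where
  cancel : ∀ g → g - (g - 1ℤ) ≡ 1ℤ
  cancel = solve-∀
  regroup : ∀ g m → (g - m) + (m - 1ℤ) ≡ g - 1ℤ
  regroup = solve-∀
  n-1∣g-1 : + n - 1ℤ ∣ₛ geom (+ n) n - 1ℤ
  n-1∣g-1 = subst (+ n - 1ℤ ∣ₛ_) (regroup (geom (+ n) n) (+ n)) (∣m∣n⇒∣m+n (u-1∣geom-n (+ n) n) ∣-refl)

geom∣t[pᵃ-1]-1 : ∀ m a t → ℕ.Coprime a (suc m) →
                 + suc m * t ≡ weighted ((+ suc m) ℤ.^ a) m →
                 geom (+ suc m) (suc m) ∣ₛ t * ((+ suc m) ℤ.^ a - 1ℤ) - 1ℤ
geom∣t[pᵃ-1]-1 m a t a⊥p p*t≡weighted =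
  ∣ᵤ⇒∣ (coprime-divisor K P (t * (X - 1ℤ) - 1ℤ) (geom-suc-coprime P m) (∣⇒∣ᵤ K∣p*[t*[X-1]-1]))
  where
  p : ℕ
  p = suc m
  P K X : ℤ
  P = + p
  K = geom P p
  X = P ℤ.^ a

  K∣Xᵖ-1 : K ∣ₛ X ℤ.^ p - 1ℤ
  K∣Xᵖ-1 = subst (λ e → K ∣ₛ e - 1ℤ) Pᵖᵃ≡Xᵖ (∣uᵃ-1⇒∣uᵃⁿ-1 P p a (geom∣uⁿ-1 P p))
    where
    Pᵖᵃ≡Xᵖ : P ℤ.^ (p ℕ.* a) ≡ X ℤ.^ p
    Pᵖᵃ≡Xᵖ = trans (cong (P ℤ.^_) (ℕ.*-comm p a)) (sym (^-*-assoc P a p))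

  K⊥X-1 : Coprime K (X - 1ℤ)
  K⊥X-1 = common-divisor∣1⇒coprime {K} {X - 1ℤ} λ d∣K d∣X-1 →
    coprime∧∣∧∣⇒∣1 (geom-self-coprime-pred p) d∣K
      (∣uᵃ-1∧∣uᵇ-1⇒∣u-1 P a⊥p d∣X-1 (∣-trans d∣K (geom∣uⁿ-1 P p)))

  K∣geom : K ∣ₛ geom X p
  K∣geom = ∣ᵤ⇒∣ (coprime-divisor K (X - 1ℤ) (geom X p) K⊥X-1
    (∣⇒∣ᵤ (subst (K ∣ₛ_) (sym ([u-1]*geom≡uⁿ-1 X p)) K∣Xᵖ-1)))

  K∣p*[t*[X-1]-1] : K ∣ₛ P * (t * (X - 1ℤ) - 1ℤ)
  K∣p*[t*[X-1]-1] = subst (K ∣ₛ_) (sym ([1+n]*[t*[u-1]-1]≡n*[uⁿ⁺¹-1]-geom X m t p*t≡weighted))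
    (∣m∣n⇒∣m-n (∣n⇒∣m*n (+ m) K∣Xᵖ-1) K∣geom)

k≡∣geom∣ : ∀ m → k (suc (suc m)) ≡ ∣ geom (+ suc (suc m)) (suc (suc m)) ∣
k≡∣geom∣ m = begin
  (p ^ p ℕ.∸ 1) ℕ./ suc m        ≡⟨ cong (ℕ._/ suc m) pᵖ-1≡g*[p-1] ⟩
  (∣ g ∣ ℕ.* suc m) ℕ./ suc m    ≡⟨ m*n/n≡m ∣ g ∣ (suc m) ⟩
  ∣ g ∣                          ∎
  where
  p : ℕ
  p = suc (suc m)
  g : ℤ
  g = geom (+ p) p
  pᵖ-1≡g*[p-1] : p ^ p ℕ.∸ 1 ≡ ∣ g ∣ ℕ.* suc m
  pᵖ-1≡g*[p-1] = begin
    ∣ + (p ^ p ℕ.∸ 1) ∣        ≡⟨ cong ∣_∣ (⊖-≥ (ℕ.m^n>0 p p)) ⟨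
    ∣ + (p ^ p) - 1ℤ ∣         ≡⟨ cong (∣_∣ ∘ (_- 1ℤ)) (pos-^ p p) ⟩
    ∣ (+ p) ℤ.^ p - 1ℤ ∣       ≡⟨ cong ∣_∣ ([u-1]*geom≡uⁿ-1 (+ p) p) ⟨
    ∣ + suc m * g ∣            ≡⟨ abs-* (+ suc m) g ⟩
    suc m ℕ.* ∣ g ∣            ≡⟨ ℕ.*-comm (suc m) ∣ g ∣ ⟩
    ∣ g ∣ ℕ.* suc m            ∎

sum-upTo-suc : ∀ (f : ℕ → ℕ) n → sum (map f (upTo (suc n))) ≡ sum (map f (upTo n)) ℕ.+ f n
sum-upTo-suc f n = begin
  sum (map f (upTo (suc n)))             ≡⟨ cong (sum ∘ map f) (upTo-∷ʳ n) ⟨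
  sum (map f (upTo n ++ [ n ]))          ≡⟨ cong sum (map-++ f (upTo n) [ n ]) ⟩
  sum (map f (upTo n) ++ [ f n ])        ≡⟨ sum-++ (map f (upTo n)) [ f n ] ⟩
  sum (map f (upTo n)) ℕ.+ (f n ℕ.+ 0)   ≡⟨ cong (sum (map f (upTo n)) ℕ.+_) (ℕ.+-identityʳ (f n)) ⟩
  sum (map f (upTo n)) ℕ.+ f n           ∎

p*τ≡weighted : ∀ p a → + p * + τ p (suc a) ≡ weighted ((+ p) ℤ.^ suc a) (p ℕ.∸ 1)
p*τ≡weighted p a = p*partial≡weighted (p ℕ.∸ 1)
  where
  X : ℤ
  X = (+ p) ℤ.^ suc a
  term : ℕ → ℕ
  term i = let j = suc i in j ℕ.* p ^ (j ℕ.* suc a ℕ.∸ 1)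

  swap : ∀ x y z → x ℕ.* (y ℕ.* z) ≡ y ℕ.* (x ℕ.* z)
  swap = ℕ-solve-∀

  p*term≡j*Xʲ : ∀ i → + p * + term i ≡ + suc i * X ℤ.^ suc i
  p*term≡j*Xʲ i = begin
    + p * + term i                             ≡⟨ pos-* p (term i) ⟨
    + (p ℕ.* term i)                           ≡⟨ cong +_ (swap p (suc i) _) ⟩
    + (suc i ℕ.* p ^ (suc i ℕ.* suc a))        ≡⟨ pos-* (suc i) _ ⟩
    + suc i * + (p ^ (suc i ℕ.* suc a))        ≡⟨ cong (+ suc i *_) (pos-^ p (suc i ℕ.* suc a)) ⟩
    + suc i * (+ p) ℤ.^ (suc i ℕ.* suc a)      ≡⟨ cong (λ e → + suc i * (+ p) ℤ.^ e) (ℕ.*-comm (suc i) (suc a)) ⟩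
    + suc i * (+ p) ℤ.^ (suc a ℕ.* suc i)      ≡⟨ cong (+ suc i *_) (^-*-assoc (+ p) (suc a) (suc i)) ⟨
    + suc i * X ℤ.^ suc i                      ∎

  p*partial≡weighted : ∀ n → + p * + sum (map term (upTo n)) ≡ weighted X n
  p*partial≡weighted zero    = *-zeroʳ (+ p)
  p*partial≡weighted (suc n) = begin
    + p * + sum (map term (upTo (suc n)))                      ≡⟨ cong (λ s → + p * + s) (sum-upTo-suc term n) ⟩
    + p * (+ sum (map term (upTo n)) + + term n)               ≡⟨ *-distribˡ-+ (+ p) _ (+ term n) ⟩
    + p * + sum (map term (upTo n)) + + p * + term n           ≡⟨ cong₂ _+_ (p*partial≡weighted n) (p*term≡j*Xʲ n) ⟩
    weighted X n + + suc n * X ℤ.^ suc n                       ∎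

lemma3p7 : (p a : ℕ) → Prime p → a > 0 → p ∤ a →
    (+ (k p)) ∣ ((+ (τ p a)) * ((+ (p ^ a)) - (+ 1)) - (+ 1))
lemma3p7 zero          _       p-prime _  _   = contradiction p-prime ¬prime[0]
lemma3p7 (suc zero)    _       p-prime _  _   = contradiction p-prime ¬prime[1]
lemma3p7 (suc (suc m)) zero    _       () _
lemma3p7 (suc (suc m)) (suc a) p-prime _  p∤a =
  subst (ℕ._∣ ∣ t * (+ (p ^ suc a) - 1ℤ) - 1ℤ ∣) (sym (k≡∣geom∣ m)) (∣⇒∣ᵤ K∣t*[X-1]-1)
  where
  p : ℕ
  p = suc (suc m)
  t : ℤ
  t = + τ p (suc a)
  K∣t*[X-1]-1 : geom (+ p) p ∣ₛ t * (+ (p ^ suc a) - 1ℤ) - 1ℤ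
  K∣t*[X-1]-1 = subst (λ X → geom (+ p) p ∣ₛ t * (X - 1ℤ) - 1ℤ) (sym (pos-^ p (suc a)))
    (geom∣t[pᵃ-1]-1 (suc m) (suc a) t (ℕ.sym (prime∧∤⇒coprime p-prime p∤a)) (p*τ≡weighted p a))
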